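{- For all hyper-assertions $P,Q$ and every command $C$, the following are equivalent: (1) $\models\{P\}C\{Q\}$ does not hold; (2) there exists a hyper-assertion $P'$ that is satisfiable (i.e. $P'(S)$ for some set $S$ of extended states), entails $P$ (i.e. $P'(S)\Rightarrow P(S)$ for all $S$), and satisfies $\models\{P'\}C\{\neg Q\}$, where $(\neg Q)(S)$ iff not $Q(S)$.
   Context: Fix sets $\mathit{PVars}$, $\mathit{PVals}$, $\mathit{LVars}$, $\mathit{LVals}$. Program states are total functions $\sigma:\mathit{PVars}\to\mathit{PVals}$. Commands: $C ::= \mathbf{skip} \mid x:=e \mid x:=\mathrm{nonDet}() \mid \mathbf{assume}\ b \mid C;C \mid C+C \mid C^{*}$, with $x\in\mathit{PVars}$, $e$ a total function from program states to $\mathit{PVals}$, $b$ a total function from program states to Booleans. Big-step semantics $\langle C,\sigma\rangle\to\sigma'$ (inductive): $\langle\mathbf{skip},\sigma\rangle\to\sigma$; $\langle x:=e,\sigma\rangle\to\sigma[x\mapsto e(\sigma)]$; $\langle x:=\mathrm{nonDet}(),\sigma\rangle\to\sigma[x\mapsto v]$ for all $v$; $\langle\mathbf{assume}\ b,\sigma\rangle\to\sigma$ if $b(\sigma)$; sequential composition composes executions; $C_1+C_2$ executes either branch; $\langle C^*,\sigma\rangle\to\sigma$, and $\langle C^*,\sigma\rangle\to\sigma''$ whenever $\langle C,\sigma\rangle\to\sigma'$ and $\langle C^*,\sigma'\rangle\to\sigma''$. Extended states are pairs $\varphi=(\varphi^L,\varphi^P)$ with $\varphi^L:\mathit{LVars}\to\mathit{LVals}$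 and $\varphi^P$ a program state; $\mathit{sem}(C,S)=\{\varphi\mid\exists\sigma.(\varphi^L,\sigma)\in S\wedge\langle C,\sigma\rangle\to\varphi^P\}$. A hyper-assertion is a function from sets of extended states to Booleans; $\models\{P\}C\{Q\}$ iff for all sets $S$ of extended states, $P(S)$ implies $Q(\mathit{sem}(C,S))$. -}

module Defs where

open import Level using (Level; 0ℓ) renaming (suc to lsuc)
open import Data.Bool using (Bool; true)
open import Data.Product using (Σ; ∃; _×_; _,_; proj₁; proj₂)
open import Relation.Binary.PropositionalEquality using (_≡_)
open import Relation.Nullary using (¬_)

PState : Set → Set → Set
PState PVars PVals = PVars → PVals

data Cmd (PVars PVals : Set) : Set where
  skip   : Cmd PVars PVals
  assign : PVars → (PState PVars PVals → PVals) → Cmd PVars PVals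
  havoc  : PVars → Cmd PVars PVals
  assume : (PState PVars PVals → Bool) → Cmd PVars PVals
  _⨾_    : Cmd PVars PVals → Cmd PVars PVals → Cmd PVars PVals
  _⊕_    : Cmd PVars PVals → Cmd PVars PVals → Cmd PVars PVals
  _*     : Cmd PVars PVals → Cmd PVars PVals

IsUpdate : {PVars PVals : Set} → PState PVars PVals → PVars → PVals →
           PState PVars PVals → Set
IsUpdate σ x v σ' = (σ' x ≡ v) × (∀ y → ¬ (y ≡ x) → σ' y ≡ σ y)

data BigStep {PVars PVals : Set} :
     Cmd PVars PVals → PState PVars PVals → PState PVars PVals → Set where
  bs-skip   : ∀ {σ} → BigStep skip σ σ
  bs-assign : ∀ {x e σ σ'} → IsUpdate σ x (e σ) σ' → BigStep (assign x e) σ σ'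
  bs-havoc  : ∀ {x σ σ'} (v : PVals) → IsUpdate σ x v σ' → BigStep (havoc x) σ σ'
  bs-assume : ∀ {b σ} → b σ ≡ true → BigStep (assume b) σ σ
  bs-seq    : ∀ {C₁ C₂ σ σ' σ''} → BigStep C₁ σ σ' → BigStep C₂ σ' σ'' →
              BigStep (C₁ ⨾ C₂) σ σ''
  bs-choiceˡ : ∀ {C₁ C₂ σ σ'} → BigStep C₁ σ σ' → BigStep (C₁ ⊕ C₂) σ σ'
  bs-choiceʳ : ∀ {C₁ C₂ σ σ'} → BigStep C₂ σ σ' → BigStep (C₁ ⊕ C₂) σ σ'
  bs-star0  : ∀ {C σ} → BigStep (C *) σ σ
  bs-starS  : ∀ {C σ σ' σ''} → BigStep C σ σ' → BigStep (C *) σ' σ'' →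
              BigStep (C *) σ σ''

ExtState : (PVars PVals LVars LVals : Set) → Set
ExtState PVars PVals LVars LVals = (LVars → LVals) × PState PVars PVals

ExtSet : (PVars PVals LVars LVals : Set) → Set₁
ExtSet PVars PVals LVars LVals = ExtState PVars PVals LVars LVals → Set

HyperAssertion : (PVars PVals LVars LVals : Set) → Set₂
HyperAssertion PVars PVals LVars LVals = ExtSet PVars PVals LVars LVals → Set₁

module _ {PVars PVals LVars LVals : Set} where

  sem : Cmd PVars PVals → ExtSet PVars PVals LVars LVals → ExtSet PVars PVals LVars LVals
  sem C S φ = ∃ λ σ → S (proj₁ φ , σ) × BigStep C σ (proj₂ φ)

  Valid : HyperAssertion PVars PVals LVars LVals → Cmd PVars PVals →
          HyperAssertion PVars PVals LVars LVals → Set₁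
  Valid P C Q = ∀ (S : ExtSet PVars PVals LVars LVals) → P S → Q (sem C S)

  NotH : HyperAssertion PVars PVals LVars LVals → HyperAssertion PVars PVals LVars LVals
  NotH Q S = ¬ Q S

  Satisfiable : HyperAssertion PVars PVals LVars LVals → Set₁
  Satisfiable P = ∃ λ (S : ExtSet PVars PVals LVars LVals) → P S

  Entails : HyperAssertion PVars PVals LVars LVals → HyperAssertion PVars PVals LVars LVals → Set₁
  Entails P' P = ∀ S → P' S → P S

{-# OPTIONS --safe #-}
module Submission where

-- If {P} C {Q} fails, classically there is a counterexample S with P S and
-- ¬ Q (sem C S); the singleton precondition "equal to S" is then satisfiable,
-- entails P and ensures ¬ Q. Conversely, any S satisfying such a P' is a
-- counterexample to {P} C {Q}, constructively.

open import Defs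
open import Axiom.ExcludedMiddle using (ExcludedMiddle)
open import Level using (_⊔_)
open import Data.Product using (∃; _×_; _,_)
open import Function.Bundles using (_⇔_; mk⇔)
open import Relation.Nullary using (¬_; yes; no; contradiction)
open import Relation.Nullary.Decidable using (decidable-stable)
open import Relation.Binary.PropositionalEquality using (_≡_; refl)

¬∀⇒∃¬ : ∀ {a b c} → ExcludedMiddle (a ⊔ b ⊔ c) → ExcludedMiddle c →
        {A : Set a} {B : A → Set b} {R : A → Set c} →
        ¬ (∀ x → B x → R x) → ∃ λ x → B x × ¬ R x
¬∀⇒∃¬ em emR {A} {B} {R} ¬∀ with em {∃ λ x → B x × ¬ R x}
... | yes counterexample = counterexample
... | no  none =
  contradiction (λ x Bx → decidable-stable emR λ ¬Rx → none (x , Bx , ¬Rx)) ¬∀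

module _ {PVars PVals LVars LVals : Set} where

  private
    HA = HyperAssertion PVars PVals LVars LVals

  Singleton : ExtSet PVars PVals LVars LVals → HA
  Singleton S T = T ≡ S

  singleton-satisfiable : ∀ S → Satisfiable (Singleton S)
  singleton-satisfiable S = S , refl

  singleton-entails : ∀ {P : HA} {S} → P S → Entails (Singleton S) P
  singleton-entails PS _ refl = PS

  valid-singleton : ∀ (Q : HA) C {S} → Q (sem C S) → Valid (Singleton S) C Q
  valid-singleton _ _ QS _ refl = QS

  refuted-by-strengthening : ∀ {P P' : HA} (Q : HA) C →
    Satisfiable P' → Entails P' P → Valid P' C (NotH Q) → ¬ Valid P C Q
  refuted-by-strengthening _ _ (S , P'S) P'⇒P valid¬Q validQ =
    valid¬Q S P'S (validQ S (P'⇒P S P'S))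

mainTheorem5 : (em : ∀ {ℓ} → ExcludedMiddle ℓ) →
    {PVars PVals LVars LVals : Set} →
    (P Q : HyperAssertion PVars PVals LVars LVals) (C : Cmd PVars PVals) →
    (¬ Valid P C Q) ⇔
      (∃ λ (P' : HyperAssertion PVars PVals LVars LVals) →
        Satisfiable P' × Entails P' P × Valid P' C (NotH Q))
mainTheorem5 em P Q C = mk⇔ strengthen
  (λ (_ , sat , entails , valid) → refuted-by-strengthening Q C sat entails valid)
  where
  strengthen : ¬ Valid P C Q → ∃ λ P' → Satisfiable P' × Entails P' P × Valid P' C (NotH Q)
  strengthen invalid with ¬∀⇒∃¬ em em invalid
  ... | S , PS , ¬QS =
    Singleton S , singleton-satisfiable S , singleton-entails PS , valid-singleton (NotH Q) C ¬QS
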